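{- Let $r\ge2$, $w=a_1^kva_1^m\in M_r$ with $k,m\ge0$, $|v|>0$, $v_1\ne a_1$, $v_{fin}\ne a_1$. Consider the four terms $\rho_v$, $\sigma_k(v)$, $\sigma^m(v)$, $\sigma_k^m(v)$. Each of them lies entirely in $U$ or entirely in $V$. Furthermore, if $|v|>1$ then $\sigma_k(v),\sigma^m(v),\sigma_k^m(v)\in V$; otherwise ($|v|=1$) $\sigma_k(v),\sigma^m(v)\in U$ and $\sigma_k^m(v)\in V$.
   Context: $S_r=\{a_1,\dots,a_r\}$, $M_r$ the free monoid over $S_r$; $\rho_u(w)$ counts the (possibly overlapping) occurrences of $u$ in $w$, $\rho_\epsilon(w)=|w|$. $\widehat C$ is the module of counting functions (finite linear combinations of the $\rho_u$ with coefficients in a fixed ring $\mathbb Z,\mathbb Q,\mathbb R$ or $\mathbb C$) modulo bounded functions. $B=\{\rho_w: w\in M_r,\ w_1\ne a_1,\ w_{fin}\ne a_1\}$ (including $\rho_\epsilon$) is a basis of $\widehat C$. $B_U=\{\rho_\epsilon\}\cup\{\rho_s: s\in S_r\setminus\{a_1\}\}\cup\{\rho_{s_1a_1^ks_2}: s_1,s_2\in S_r\setminus\{a_1\},\ k\ge0\}$, $B_V=B\setminus B_U$, $U=\operatorname{span}B_U$, $V=\operatorname{span}B_V$. With $T=S_r\setminus\{a_1\}$: $\sigma_k(v)=\sum_{s\in T}\sum_{i=0}^{k-1}\rho_{sa_1^iv}$, $\sigma^m(v)=\sum_{s\in T}\sum_{j=0}^{m-1}\rho_{va_1^js}$, $\sigma_k^m(v)=\sum_{s_1,s_2\in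 T}\sum_{i=0}^{k-1}\sum_{j=0}^{m-1}\rho_{s_1a_1^iva_1^js_2}$ (empty sums are $0$). -}

module Defs where

open import Data.Nat as ℕ using (ℕ; zero; suc)
open import Data.Integer as ℤ using (ℤ; +_; _-_; _*_; ∣_∣)
open import Data.Fin using (Fin; zero; suc; _≟_)
open import Data.Fin.Base using () renaming (toℕ to finToℕ)
open import Data.List using (List; []; _∷_; _++_; replicate; length; map; concatMap; applyUpTo)
open import Data.List.Relation.Unary.All using (All)
open import Data.List.Base using (allFin)
open import Data.Bool using (Bool; true; false; _∧_)
open import Data.Product using (Σ; _×_; _,_; ∃)
open import Data.Sum using (_⊎_)
open import Relation.Nullary using (¬_; does)
open import Relation.Binary.PropositionalEquality using (_≡_; _≢_)

-- Alphabet S_r with r = suc r' letters: Fin (suc r'); a₁ is 'zero'.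
Letter : ℕ → Set
Letter r' = Fin (suc r')

Word : ℕ → Set
Word r' = List (Letter r')

a₁ : ∀ {r'} → Letter r'
a₁ = zero

T : ∀ r' → List (Letter r')
T r' = map suc (allFin r')

isPrefix : ∀ {r'} → Word r' → Word r' → Bool
isPrefix [] _ = true
isPrefix (x ∷ u) [] = false
isPrefix (x ∷ u) (y ∷ w) = does (x ≟ y) ∧ isPrefix u w

-- number of (possibly overlapping) occurrences of a nonempty word u in w
occ : ∀ {r'} → Word r' → Word r' → ℕ
occ u [] = 0
occ u (y ∷ w) with isPrefix u (y ∷ w)
... | true = suc (occ u w)
... | false = occ u w

ρ : ∀ {r'} → Word r' → Word r' → ℤ
ρ [] w = + length w
ρ u@(_ ∷ _) w = + occ u w

sumℤ : List ℤ → ℤ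
sumℤ [] = + 0
sumℤ (x ∷ xs) = x ℤ.+ sumℤ xs

LinComb : ℕ → Set
LinComb r' = List (ℤ × Word r')

eval : ∀ {r'} → LinComb r' → Word r' → ℤ
eval [] w = + 0
eval ((c , u) ∷ L) w = c * ρ u w ℤ.+ eval L w

BoundedDiff : ∀ {r'} → (Word r' → ℤ) → (Word r' → ℤ) → Set
BoundedDiff {r'} f g = ∃ λ (C : ℕ) → ∀ (w : Word r') → ∣ f w - g w ∣ ℕ.≤ C

data FirstLastNotA₁ {r'} : Word r' → Set where
  single : ∀ {s} → s ≢ a₁ → FirstLastNotA₁ (s ∷ [])
  multi  : ∀ {s t} (u : Word r') → s ≢ a₁ → t ≢ a₁ → FirstLastNotA₁ (s ∷ u ++ t ∷ [])

InB : ∀ {r'} → Word r' → Set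
InB u = u ≡ [] ⊎ FirstLastNotA₁ u

data InBU {r'} : Word r' → Set where
  eps  : InBU []
  lett : ∀ {s} → s ≢ a₁ → InBU (s ∷ [])
  mid  : ∀ {s₁ s₂} (k : ℕ) → s₁ ≢ a₁ → s₂ ≢ a₁ →
         InBU (s₁ ∷ replicate k a₁ ++ s₂ ∷ [])

InBV : ∀ {r'} → Word r' → Set
InBV u = InB u × ¬ InBU u

-- membership in U = span B_U and V = span B_V inside Ĉ (counting functions mod bounded)
InU : ∀ {r'} → (Word r' → ℤ) → Set
InU {r'} f = Σ (LinComb r') λ L → All (λ p → InBU (Data.Product.proj₂ p)) L × BoundedDiff f (eval L)

InV : ∀ {r'} → (Word r' → ℤ) → Set
InV {r'} f = Σ (LinComb r') λ L → All (λ p → InBV (Data.Product.proj₂ p)) L × BoundedDiff f (eval L)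

σ_ : ∀ {r'} → ℕ → Word r' → Word r' → ℤ
σ_ {r'} k v w = sumℤ (concatMap (λ s → applyUpTo (λ i → ρ (s ∷ replicate i a₁ ++ v) w) k) (T r'))

σ^ : ∀ {r'} → ℕ → Word r' → Word r' → ℤ
σ^ {r'} m v w = sumℤ (concatMap (λ s → applyUpTo (λ j → ρ (v ++ replicate j a₁ ++ s ∷ []) w) m) (T r'))

σ_^ : ∀ {r'} → ℕ → ℕ → Word r' → Word r' → ℤ
σ_^ {r'} k m v w = sumℤ
  (concatMap (λ s₁ → concatMap (λ s₂ → concatMap (λ i → applyUpTo (λ j →
     ρ (s₁ ∷ replicate i a₁ ++ v ++ replicate j a₁ ++ s₂ ∷ []) w) m) (applyUpTo (λ i → i) k)) (T r')) (T r'))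

-- Each of the four terms is, pointwise, a sum of counting functions ρ_u with u ranging over words
-- of a single shape (v, s a₁^i v, v a₁^j s or s₁ a₁^i v a₁^j s₂ with s, s₁, s₂ ≠ a₁). A word of B
-- with first and last letters ≠ a₁ lies in B_U exactly when everything in between is a₁, so the
-- shape decides the side: if |v| > 1, the first or last letter of v is an inner letter ≠ a₁ of
-- every extension word; if v is a single letter t, the words s a₁^i t and t a₁^j s are of the
-- form s₁ a₁^k s₂, whereas t is an inner letter of s₁ a₁^i t a₁^j s₂.
module Submission where

open import Defs
open import Data.Nat using (ℕ; suc; _<_)
open import Data.Nat.Properties using (≤-reflexive; <-irrefl; suc-injective; 1+n≢0)
open import Data.Integer using (ℤ; +_; _+_; ∣_∣)
open import Data.Integer.Properties using (i≡j⇒i-j≡0; *-identityˡ; +-identityʳ)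
open import Data.Fin using (_≟_)
open import Data.List using (List; []; _∷_; _++_; replicate; length; head; last; map; concatMap; applyUpTo; initLast; _∷ʳ′_)
open import Data.List.Properties using (∷-injectiveʳ; ++-assoc; ∷ʳ-injectiveˡ; map-concatMap; concatMap-cong; map-applyUpTo; length-++-sucʳ)
open import Data.List.Relation.Unary.All using (All; []; _∷_; all?)
open import Data.List.Relation.Unary.All.Properties using (map⁺; concat⁺; tabulate⁺; applyUpTo⁺₂; replicate⁺; ¬All⇒Any¬; Any¬⇒¬All)
open import Data.List.Relation.Unary.Any using (Any; here)
open import Data.List.Relation.Unary.Any.Properties using (++⁺ˡ; ++⁺ʳ)
open import Data.Maybe using (just)
open import Data.Product using (Σ; _×_; _,_; proj₂)
open import Data.Sum using (_⊎_; inj₁; inj₂)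
import Data.Sum as Sum
open import Relation.Nullary using (yes; no; contradiction)
open import Relation.Binary.PropositionalEquality using (_≡_; _≢_; _≗_; refl; sym; trans; cong; cong₂; subst)

private
  variable
    A : Set
    r' : ℕ
    s t : Letter r'
    v x : Word r'

last-∷ʳ : (xs : List A) (y : A) → last (xs ++ y ∷ []) ≡ just y
last-∷ʳ []           y = refl
last-∷ʳ (_ ∷ [])     y = refl
last-∷ʳ (_ ∷ z ∷ zs) y = last-∷ʳ (z ∷ zs) y

All≡⇒replicate : {a : A} {xs : List A} → All (_≡ a) xs → xs ≡ replicate (length xs) a
All≡⇒replicate []           = refl
All≡⇒replicate (refl ∷ eqs) = cong (_ ∷_) (All≡⇒replicate eqs)

InBU⇒interior-a₁ : {u : Word r'} → InBU u → u ≡ s ∷ x ++ t ∷ [] → All (_≡ a₁) x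
InBU⇒interior-a₁ {x = []}    (lett _)    ()
InBU⇒interior-a₁ {x = _ ∷ _} (lett _)    ()
InBU⇒interior-a₁ {x = x}     (mid k _ _) eq =
  subst (All (_≡ a₁)) (∷ʳ-injectiveˡ (replicate k a₁) x (∷-injectiveʳ eq)) (replicate⁺ k refl)

InBV-interior : s ≢ a₁ → t ≢ a₁ → Any (_≢ a₁) x → InBV (s ∷ x ++ t ∷ [])
InBV-interior s≢a₁ t≢a₁ inner =
  inj₂ (multi _ s≢a₁ t≢a₁) , λ inBU → Any¬⇒¬All inner (InBU⇒interior-a₁ inBU refl)

FirstLastNotA₁⇒InBU⊎InBV : {u : Word r'} → FirstLastNotA₁ u → InBU u ⊎ InBV u
FirstLastNotA₁⇒InBU⊎InBV (single s≢a₁) = inj₁ (lett s≢a₁)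
FirstLastNotA₁⇒InBU⊎InBV (multi {s} {t} x s≢a₁ t≢a₁) with all? (_≟ a₁) x
... | yes x-a₁ =
  inj₁ (subst (λ y → InBU (s ∷ y ++ t ∷ [])) (sym (All≡⇒replicate x-a₁)) (mid (length x) s≢a₁ t≢a₁))
... | no ¬x-a₁ = inj₂ (InBV-interior s≢a₁ t≢a₁ (¬All⇒Any¬ (_≟ a₁) x ¬x-a₁))

head-last⇒FirstLastNotA₁ : (v : Word r') → 0 < length v → head v ≢ just a₁ → last v ≢ just a₁ →
                           FirstLastNotA₁ v
head-last⇒FirstLastNotA₁ v 0<|v| h≢ l≢ with initLast v
... | []            = contradiction 0<|v| λ ()
... | [] ∷ʳ′ t      = single (λ t≡a₁ → l≢ (cong just t≡a₁))
... | (s ∷ u) ∷ʳ′ t = multi u (λ s≡a₁ → h≢ (cong just s≡a₁))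
                              (λ t≡a₁ → l≢ (trans (last-∷ʳ (s ∷ u) t) (cong just t≡a₁)))

-- InU = Spanned InBU and InV = Spanned InBV, definitionally.
Spanned : (Word r' → Set) → (Word r' → ℤ) → Set
Spanned {r'} P f = Σ (LinComb r') λ L → All (λ p → P (proj₂ p)) L × BoundedDiff f (eval L)

ρ-sum : List (Word r') → Word r' → ℤ
ρ-sum us w = sumℤ (map (λ u → ρ u w) us)

eval-unit-coefficients : (us : List (Word r')) → eval (map (+ 1 ,_) us) ≗ ρ-sum us
eval-unit-coefficients []       w = refl
eval-unit-coefficients (u ∷ us) w = cong₂ _+_ (*-identityˡ (ρ u w)) (eval-unit-coefficients us w)

≗⇒BoundedDiff : {f g : Word r' → ℤ} → f ≗ g → BoundedDiff f g
≗⇒BoundedDiff f≗g = 0 , λ w → ≤-reflexive (cong ∣_∣ (i≡j⇒i-j≡0 (f≗g w)))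

Spanned-ρ-sum : {P : Word r' → Set} {f : Word r' → ℤ} {us : List (Word r')} →
                All P us → f ≗ ρ-sum us → Spanned P f
Spanned-ρ-sum {us = us} Pus f≗ρ-sum =
  map (+ 1 ,_) us , map⁺ Pus , ≗⇒BoundedDiff (λ w → trans (f≗ρ-sum w) (sym (eval-unit-coefficients us w)))

Spanned-ρ : {P : Word r' → Set} {u : Word r'} → P u → Spanned P (ρ u)
Spanned-ρ {u = u} Pu = Spanned-ρ-sum (Pu ∷ []) (λ w → sym (+-identityʳ (ρ u w)))

InU⊎InV-ρ : {u : Word r'} → FirstLastNotA₁ u → InU (ρ u) ⊎ InV (ρ u)
InU⊎InV-ρ fl = Sum.map Spanned-ρ Spanned-ρ (FirstLastNotA₁⇒InBU⊎InBV fl)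

All-T : {P : Letter r' → Set} → (∀ {s} → s ≢ a₁ → P s) → All P (T r')
All-T P-nonA₁ = map⁺ (tabulate⁺ (λ _ → P-nonA₁ λ ()))

map-concatMap-≗ : {B C : Set} {f : B → C} {g : A → List B} {h : A → List C} →
                  (∀ a → map f (g a) ≡ h a) → ∀ as → map f (concatMap g as) ≡ concatMap h as
map-concatMap-≗ {f = f} {g} eq as = trans (map-concatMap f g as) (concatMap-cong eq as)

left-extensions : ℕ → Word r' → List (Word r')
left-extensions {r'} k v = concatMap (λ s → applyUpTo (λ i → s ∷ replicate i a₁ ++ v) k) (T r')

right-extensions : ℕ → Word r' → List (Word r')
right-extensions {r'} m v = concatMap (λ s → applyUpTo (λ j → v ++ replicate j a₁ ++ s ∷ []) m) (T r')

two-sided-extensions : ℕ → ℕ → Word r' → List (Word r')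
two-sided-extensions {r'} k m v =
  concatMap (λ s₁ → concatMap (λ s₂ → concatMap (λ i → applyUpTo (λ j →
    s₁ ∷ replicate i a₁ ++ v ++ replicate j a₁ ++ s₂ ∷ []) m) (applyUpTo (λ i → i) k)) (T r')) (T r')

left-σ≗ρ-sum : (k : ℕ) (v : Word r') → σ_ k v ≗ ρ-sum (left-extensions k v)
left-σ≗ρ-sum {r'} k v w = cong sumℤ (sym (map-concatMap-≗ (λ _ → map-applyUpTo _ _ k) (T r')))

right-σ≗ρ-sum : (m : ℕ) (v : Word r') → σ^ m v ≗ ρ-sum (right-extensions m v)
right-σ≗ρ-sum {r'} m v w = cong sumℤ (sym (map-concatMap-≗ (λ _ → map-applyUpTo _ _ m) (T r')))

two-sided-σ≗ρ-sum : (k m : ℕ) (v : Word r') → σ_^ k m v ≗ ρ-sum (two-sided-extensions k m v)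
two-sided-σ≗ρ-sum {r'} k m v w = cong sumℤ (sym (map-concatMap-≗ (λ _ → map-concatMap-≗ (λ _ →
  map-concatMap-≗ (λ _ → map-applyUpTo _ _ m) (applyUpTo (λ i → i) k)) (T r')) (T r')))

Spanned-left-σ : {P : Word r' → Set} (k : ℕ) (v : Word r') →
                 (∀ {s} i → s ≢ a₁ → P (s ∷ replicate i a₁ ++ v)) → Spanned P (σ_ k v)
Spanned-left-σ k v P-ext =
  Spanned-ρ-sum (concat⁺ (map⁺ (All-T λ s≢a₁ → applyUpTo⁺₂ _ k λ i → P-ext i s≢a₁))) (left-σ≗ρ-sum k v)

Spanned-right-σ : {P : Word r' → Set} (m : ℕ) (v : Word r') →
                  (∀ {s} j → s ≢ a₁ → P (v ++ replicate j a₁ ++ s ∷ [])) → Spanned P (σ^ m v)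
Spanned-right-σ m v P-ext =
  Spanned-ρ-sum (concat⁺ (map⁺ (All-T λ s≢a₁ → applyUpTo⁺₂ _ m λ j → P-ext j s≢a₁))) (right-σ≗ρ-sum m v)

Spanned-two-sided-σ : {P : Word r' → Set} (k m : ℕ) (v : Word r') →
                      (∀ {s₁ s₂} i j → s₁ ≢ a₁ → s₂ ≢ a₁ →
                         P (s₁ ∷ replicate i a₁ ++ v ++ replicate j a₁ ++ s₂ ∷ [])) →
                      Spanned P (σ_^ k m v)
Spanned-two-sided-σ k m v P-ext =
  Spanned-ρ-sum (concat⁺ (map⁺ (All-T λ s₁≢a₁ → concat⁺ (map⁺ (All-T λ s₂≢a₁ →
                   concat⁺ (map⁺ (applyUpTo⁺₂ _ k λ i → applyUpTo⁺₂ _ m λ j → P-ext i j s₁≢a₁ s₂≢a₁)))))))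
    (two-sided-σ≗ρ-sum k m v)

InU-left-σ-letter : (k : ℕ) → t ≢ a₁ → InU (σ_ k (t ∷ []))
InU-left-σ-letter {t = t} k t≢a₁ = Spanned-left-σ k (t ∷ []) λ i s≢a₁ → mid i s≢a₁ t≢a₁

InU-right-σ-letter : (m : ℕ) → t ≢ a₁ → InU (σ^ m (t ∷ []))
InU-right-σ-letter {t = t} m t≢a₁ = Spanned-right-σ m (t ∷ []) λ j s≢a₁ → mid j t≢a₁ s≢a₁

InV-left-σ : (k : ℕ) → t ≢ a₁ → Any (_≢ a₁) x → InV (σ_ k (x ++ t ∷ []))
InV-left-σ {t = t} {x = x} k t≢a₁ inner = Spanned-left-σ k (x ++ t ∷ []) λ {s} i s≢a₁ →
  subst InBV (cong (s ∷_) (++-assoc (replicate i a₁) x (t ∷ [])))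
    (InBV-interior s≢a₁ t≢a₁ (++⁺ʳ (replicate i a₁) inner))

InV-right-σ : (m : ℕ) → s ≢ a₁ → Any (_≢ a₁) x → InV (σ^ m (s ∷ x))
InV-right-σ {s = s} {x = x} m s≢a₁ inner = Spanned-right-σ m (s ∷ x) λ {s′} j s′≢a₁ →
  subst InBV (cong (s ∷_) (++-assoc x (replicate j a₁) (s′ ∷ [])))
    (InBV-interior s≢a₁ s′≢a₁ (++⁺ˡ inner))

InV-two-sided-σ : (k m : ℕ) (v : Word r') → Any (_≢ a₁) v → InV (σ_^ k m v)
InV-two-sided-σ k m v inner = Spanned-two-sided-σ k m v λ {s₁} {s₂} i j s₁≢a₁ s₂≢a₁ →
  subst InBV (cong (s₁ ∷_) (trans (++-assoc (replicate i a₁) (v ++ replicate j a₁) (s₂ ∷ []))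
                                  (cong (replicate i a₁ ++_) (++-assoc v (replicate j a₁) (s₂ ∷ [])))))
    (InBV-interior s₁≢a₁ s₂≢a₁ (++⁺ʳ (replicate i a₁) (++⁺ˡ inner)))

lemma3p3 : (n : ℕ) (k m : ℕ) (v : Word (suc n)) →
    0 < length v → head v ≢ just a₁ → last v ≢ just a₁ →
    ((InU (ρ v) ⊎ InV (ρ v)) × (InU (σ_ k v) ⊎ InV (σ_ k v))
      × (InU (σ^ m v) ⊎ InV (σ^ m v)) × (InU (σ_^ k m v) ⊎ InV (σ_^ k m v)))
    × (1 < length v → InV (σ_ k v) × InV (σ^ m v) × InV (σ_^ k m v))
    × (length v ≡ 1 → InU (σ_ k v) × InU (σ^ m v) × InV (σ_^ k m v))
lemma3p3 n k m v 0<|v| h≢ l≢ with head-last⇒FirstLastNotA₁ v 0<|v| h≢ l≢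
... | fl@(single t≢a₁) =
  (InU⊎InV-ρ fl , inj₁ left , inj₁ right , inj₂ two-sided) ,
  (λ 1<1 → contradiction 1<1 (<-irrefl refl)) ,
  (λ _ → left , right , two-sided)
  where
  left : InU (σ_ k v)
  left = InU-left-σ-letter k t≢a₁
  right : InU (σ^ m v)
  right = InU-right-σ-letter m t≢a₁
  two-sided : InV (σ_^ k m v)
  two-sided = InV-two-sided-σ k m v (here t≢a₁)
... | fl@(multi {b} {t} u b≢a₁ t≢a₁) =
  (InU⊎InV-ρ fl , inj₂ left , inj₂ right , inj₂ two-sided) ,
  (λ _ → left , right , two-sided) ,
  (λ |v|≡1 → contradiction (trans (sym (length-++-sucʳ u t [])) (suc-injective |v|≡1)) 1+n≢0)
  where
  left : InV (σ_ k v)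
  left = InV-left-σ {x = b ∷ u} k t≢a₁ (here b≢a₁)
  right : InV (σ^ m v)
  right = InV-right-σ m b≢a₁ (++⁺ʳ u (here t≢a₁))
  two-sided : InV (σ_^ k m v)
  two-sided = InV-two-sided-σ k m v (here b≢a₁)
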